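{- Let $\Phi$ be a finite crystallographic root system. Every cover relation of the weak order restricted to the set of $\Phi$-posets is a cover relation of the weak order on all subsets of $\Phi$. In particular, the weak order on $\Phi$-posets is graded by $R\mapsto|R^-|-|R^+|$.
   Context: Let $V$ be a real Euclidean space with scalar product $\langle\cdot,\cdot\rangle$. For $\alpha\neq0$ let $\alpha^\vee=2\alpha/\langle\alpha,\alpha\rangle$ and $s_\alpha(v)=v-\langle\alpha^\vee,v\rangle\alpha$. A finite root system is a finite set $\Phi\subset V\setminus\{0\}$ with $\Phi\cap\mathbb{R}\alpha=\{\alpha,-\alpha\}$ and $s_\alpha\Phi=\Phi$ for all $\alpha\in\Phi$; it is crystallographic if $\langle\alpha^\vee,\beta\rangle\in\mathbb{Z}$ for all $\alpha,\beta\in\Phi$. Fix a generic linear functional $f$ and let $\Phi^+=\{\alpha\in\Phi: f(\alpha)>0\}$, $\Phi^-=\{\alpha\in\Phi:f(\alpha)<0\}$. For $R\subseteq\Phi$ write $R^+=R\cap\Phi^+$, $R^-=R\cap\Phi^-$. The weak order on subsets of $\Phi$ is: $R\le S$ iff $R^+\supseteq S^+$ and $R^-\subseteq S^-$; its cover relations are $R\lessdot R\setminus\{\alpha\}$ for $\alpha\in R^+$ and $R\setminus\{\beta\}\lessdot R$ for $\beta\in R^-$. A subset $R$ is antisymmetric if $R\cap-R=\varnothing$, and closed if $\alpha,\beta\in R$, $m,n\in\mathbb{N}$, $m\alpha+n\beta\in\Phi$ imply $m\alpha+n\beta\in R$. A $\Phi$-poset is an antisymmetric closed subset of $\Phi$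.
   Formalization: The space $V$ is ℚ^n with the standard scalar product rather than a real Euclidean space, and the functional $f$ is a rational vector, so the roots have rational coordinates. -}

module Defs where

open import Data.Nat using (ℕ; suc)
open import Data.Integer as ℤ using (ℤ)
open import Data.Rational as ℚ using (ℚ; 0ℚ; 1ℚ)
open import Data.Rational.Properties as ℚP using ()
open import Data.Fin using (Fin)
open import Data.Empty as Empty using ()
open import Data.Unit as Unit using ()
open import Data.Vec as Vec using (Vec)
open import Data.Fin.Subset as Sub using (Subset; _∈_; _⊆_; _∩_; ∣_∣; ∁)
open import Data.Product using (Σ; ∃; ∃-syntax; _×_; _,_)
open import Data.Sum using (_⊎_)
open import Relation.Nullary using (¬_; does)
open import Relation.Binary.PropositionalEquality using (_≡_; _≢_)
open import Function.Definitions using (Injective)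

Vect : ℕ → Set
Vect n = Vec ℚ n

_⊕_ : ∀ {n} → Vect n → Vect n → Vect n
u ⊕ v = Vec.zipWith ℚ._+_ u v

_⊖_ : ∀ {n} → Vect n → Vect n → Vect n
u ⊖ v = Vec.zipWith ℚ._-_ u v

_⊛_ : ∀ {n} → ℚ → Vect n → Vect n
c ⊛ v = Vec.map (c ℚ.*_) v

⟨_,_⟩ : ∀ {n} → Vect n → Vect n → ℚ
⟨ u , v ⟩ = Vec.foldr _ ℚ._+_ 0ℚ (Vec.zipWith ℚ._*_ u v)

zeroV : ∀ {n} → Vect n
zeroV = Vec.replicate _ 0ℚ

ℕtoℚ : ℕ → ℚ
ℕtoℚ m = ℤ.+ m ℚ./ 1

ℤtoℚ : ℤ → ℚ
ℤtoℚ z = z ℚ./ 1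

two : ℚ
two = ℕtoℚ 2

record RootSystem (n k : ℕ) : Set where
  field
    root      : Fin k → Vect n
    injective : Injective _≡_ _≡_ root
    nonzero   : ∀ i → root i ≢ zeroV
    -- Φ ∩ ℝα = {α, -α}  (only ±α are proportional roots; -α ∈ Φ follows from s_α α = -α)
    reduced   : ∀ i j (c : ℚ) → root j ≡ c ⊛ root i → (c ≡ 1ℚ) ⊎ (c ≡ ℚ.- 1ℚ)
    -- s_α Φ = Φ:  s_α(β) = β - (2⟨α,β⟩/⟨α,α⟩) α ; written as ⟨α,α⟩·s_α(β) = ⟨α,α⟩β - 2⟨α,β⟩α
    -- (equivalent since ⟨α,α⟩ ≠ 0, avoiding division)
    reflect   : ∀ i j → ∃[ l ] (⟨ root i , root i ⟩ ⊛ root l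
                                 ≡ (⟨ root i , root i ⟩ ⊛ root j) ⊖ ((two ℚ.* ⟨ root i , root j ⟩) ⊛ root i))

  Crystallographic : Set
  Crystallographic = ∀ i j → ∃[ z ] (two ℚ.* ⟨ root i , root j ⟩ ≡ ℤtoℚ z ℚ.* ⟨ root i , root i ⟩)

  -- f generic: f(α) ≠ 0 for every root α  (f(v) = ⟨f,v⟩)
  Generic : Vect n → Set
  Generic f = ∀ i → ⟨ f , root i ⟩ ≢ 0ℚ

  Φ⁺ : Vect n → Subset k
  Φ⁺ f = Vec.tabulate (λ i → does (0ℚ ℚP.<? ⟨ f , root i ⟩))

  Φ⁻ : Vect n → Subset k
  Φ⁻ f = Vec.tabulate (λ i → does (⟨ f , root i ⟩ ℚP.<? 0ℚ))

  WeakLE : Vect n → Subset k → Subset k → Set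
  WeakLE f R S = ((S ∩ Φ⁺ f) ⊆ (R ∩ Φ⁺ f)) × ((R ∩ Φ⁻ f) ⊆ (S ∩ Φ⁻ f))

  WeakLT : Vect n → Subset k → Subset k → Set
  WeakLT f R S = WeakLE f R S × R ≢ S

  CoverIn : (Subset k → Set) → Vect n → Subset k → Subset k → Set
  CoverIn P f R S = P R × P S × WeakLT f R S
                    × (∀ T → P T → WeakLT f R T → WeakLT f T S → Empty.⊥)

  -- antisymmetric: R ∩ -R = ∅ (the index of -α is the root equal to (-1)·α)
  Antisymmetric : Subset k → Set
  Antisymmetric R = ∀ i j → i ∈ R → j ∈ R → root j ≢ (ℚ.- 1ℚ) ⊛ root i

  Closed : Subset k → Set
  Closed R = ∀ i j (a b : ℕ) l → i ∈ R → j ∈ R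
             → root l ≡ (ℕtoℚ a ⊛ root i) ⊕ (ℕtoℚ b ⊛ root j) → l ∈ R

  IsΦPoset : Subset k → Set
  IsΦPoset R = Antisymmetric R × Closed R

  AllSubsets : Subset k → Set
  AllSubsets _ = Unit.⊤

  rank : Vect n → Subset k → ℤ
  rank f R = ℤ.+ ∣ R ∩ Φ⁻ f ∣ ℤ.- ℤ.+ ∣ R ∩ Φ⁺ f ∣

module Submission where

-- Let R ⋖ S be a cover among Φ-posets. R ∩ S is a Φ-poset between R and S in the weak
-- order, so S ⊆ R or R ⊆ S; say S ⊊ R. If R ∖ {α} is closed for some α ∈ R ∖ S, it lies
-- between R and S, hence equals S, and S = R ∖ {α} with α positive is a cover of the weak
-- order on all subsets, raising |R⁻| - |R⁺| by one. Such an α exists: if R ∖ {α} is not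
-- closed, then α = aβ + bγ with β, γ ∈ R ∖ {α}, one of them, say β, outside the closed set
-- S, and α - β is a nonempty sum of roots of R. Writing β ≺ α for this, ≺ is a strict
-- order because Φ-posets are pointed (in a crystallographic root system two obtuse,
-- non-opposite roots add up to a root, so a vanishing sum of roots of R can be shortened),
-- and a ≺-minimal element of R ∖ S is removable.

open import Defs
open import Algebra.Bundles using (AbelianGroup)
open import Algebra.Structures using (IsAbelianGroup)
import Data.Bool as Bool
open import Data.Empty using (⊥; ⊥-elim)
open import Data.Fin as Fin using (Fin)
open import Data.Fin.Induction using (spo-wellFounded)
open import Data.Fin.Subset using (Subset)
open import Data.List using (List; []; _∷_; _++_; length; replicate)
open import Data.List.Relation.Unary.All using (All; []; _∷_; all?)
open import Data.List.Relation.Unary.All.Properties using (¬All⇒Any¬)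
import Data.List.Relation.Unary.All.Properties as All
open import Data.List.Relation.Unary.Any using (Any; here; there)
open import Data.Nat as ℕ using (ℕ; zero; suc)
open import Data.Product using (∃; ∃₂; ∃-syntax; _×_; _,_; proj₁; proj₂)
open import Data.Sum using (_⊎_; inj₁; inj₂; [_,_]′)
open import Data.Unit using (tt)
open import Data.Vec as Vec using ([]; _∷_)
import Data.Vec.Properties as Vec
open import Function using (_∘_; id)
open import Induction.WellFounded using (Acc; acc; WellFounded)
open import Relation.Binary.Definitions using (Transitive; Irreflexive; tri<; tri≈; tri>)
open import Relation.Binary.PropositionalEquality
open import Relation.Binary.Structures using (IsStrictPartialOrder)
open import Relation.Nullary using (¬_; Dec; yes; no; does; contradiction)
open import Relation.Nullary.Decidable using (dec-true; decidable-stable)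
open import Relation.Nullary.Negation using (¬¬-map)

module _ where
  open import Data.Rational using (0ℚ; 1ℚ; _+_; _*_; -_; _≤_; _<_; mkℚ; ↥_; positive; negative; nonNegative)
  import Data.Rational.Properties as ℚ
  open import Data.Rational.Solver using (module +-*-Solver)
  open +-*-Solver
  import Data.Nat.Coprimality as Coprime
  import Data.Nat.Properties as ℕ
  import Data.Integer as ℤ
  open import Relation.Binary.PropositionalEquality.Algebra using (isMagma)

  x≢0⇒0<x*x : ∀ {x} → x ≢ 0ℚ → 0ℚ < x * x
  x≢0⇒0<x*x {x} x≢0 with ℚ.<-cmp x 0ℚ
  ... | tri< x<0 _ _ = ℚ.positive⁻¹ _ {{ℚ.neg*neg⇒pos x {{negative x<0}} x {{negative x<0}}}}
  ... | tri≈ _ x≡0 _ = contradiction x≡0 x≢0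
  ... | tri> _ _ 0<x = ℚ.positive⁻¹ _ {{ℚ.pos*pos⇒pos x {{positive 0<x}} x {{positive 0<x}}}}

  0≤x*x : ∀ x → 0ℚ ≤ x * x
  0≤x*x x with x ℚ.≟ 0ℚ
  ... | yes refl = ℚ.≤-refl
  ... | no x≢0 = ℚ.<⇒≤ (x≢0⇒0<x*x x≢0)

  x+y≤0⇒x≤0 : ∀ {x y} → 0ℚ ≤ y → x + y ≤ 0ℚ → x ≤ 0ℚ
  x+y≤0⇒x≤0 {x} {y} 0≤y x+y≤0 = begin
    x      ≡⟨ ℚ.+-identityʳ x ⟨
    x + 0ℚ ≤⟨ ℚ.+-monoʳ-≤ x 0≤y ⟩
    x + y  ≤⟨ x+y≤0 ⟩
    0ℚ     ∎
    where open ℚ.≤-Reasoning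

  ≤⇒≯ : ∀ {x y} → x ≤ y → ¬ (y < x)
  ≤⇒≯ x≤y y<x = ℚ.<-irrefl refl (ℚ.<-≤-trans y<x x≤y)

  0≤p*q : ∀ {p q} → 0ℚ ≤ p → 0ℚ ≤ q → 0ℚ ≤ p * q
  0≤p*q {p} {q} 0≤p 0≤q =
    ℚ.nonNegative⁻¹ _ {{ℚ.nonNeg*nonNeg⇒nonNeg p {{nonNegative 0≤p}} q {{nonNegative 0≤q}}}}

  ℕtoℚ≡mkℚ : ∀ m → ℕtoℚ m ≡ mkℚ (ℤ.+ m) 0 (Coprime.sym (Coprime.1-coprimeTo m))
  ℕtoℚ≡mkℚ m = ℚ.normalize-coprime (Coprime.sym (Coprime.1-coprimeTo m))

  ℕtoℚ-suc : ∀ m → ℕtoℚ (suc m) ≡ 1ℚ + ℕtoℚ m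
  ℕtoℚ-suc zero = refl
  -- in normal form, 1ℚ + ℕtoℚ (suc m) computes to ℕtoℚ (2 + m * 1)
  ℕtoℚ-suc (suc m) rewrite ℕtoℚ≡mkℚ (suc m) =
    cong (λ t → ℕtoℚ (suc (suc t))) (sym (ℕ.*-identityʳ m))

  0≤ℕtoℚ : ∀ m → 0ℚ ≤ ℕtoℚ m
  0≤ℕtoℚ m rewrite ℕtoℚ≡mkℚ m = ℚ.nonNegative⁻¹ _

  ℕtoℚ≢-1 : ∀ m → ℕtoℚ m ≢ - 1ℚ
  ℕtoℚ≢-1 m eq with trans (sym (cong ↥_ (ℕtoℚ≡mkℚ m))) (cong ↥_ eq)
  ... | ()

  negV : ∀ {n} → Vect n → Vect n
  negV = Vec.map -_

  ⊕-isAbelianGroup : ∀ n → IsAbelianGroup _≡_ (_⊕_ {n}) zeroV negV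
  ⊕-isAbelianGroup n = record
    { isGroup = record
      { isMonoid = record
        { isSemigroup = record { isMagma = isMagma _⊕_ ; assoc = Vec.zipWith-assoc ℚ.+-assoc }
        ; identity    = Vec.zipWith-identityˡ ℚ.+-identityˡ , Vec.zipWith-identityʳ ℚ.+-identityʳ
        }
      ; inverse = Vec.zipWith-inverseˡ ℚ.+-inverseˡ , Vec.zipWith-inverseʳ ℚ.+-inverseʳ
      ; ⁻¹-cong = cong negV
      }
    ; comm = Vec.zipWith-comm ℚ.+-comm
    }

  ⊕-abelianGroup : ℕ → AbelianGroup _ _
  ⊕-abelianGroup n = record { isAbelianGroup = ⊕-isAbelianGroup n }

  -1⊛u≡negV : ∀ {n} (u : Vect n) → (- 1ℚ) ⊛ u ≡ negV u
  -1⊛u≡negV = Vec.map-cong λ x → trans (sym (ℚ.neg-distribˡ-* 1ℚ x)) (cong -_ (ℚ.*-identityˡ x))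

  ⊛-identityˡ : ∀ {n} (u : Vect n) → 1ℚ ⊛ u ≡ u
  ⊛-identityˡ u = trans (Vec.map-cong ℚ.*-identityˡ u) (Vec.map-id u)

  ⊛-zeroˡ : ∀ {n} (u : Vect n) → 0ℚ ⊛ u ≡ zeroV
  ⊛-zeroˡ u = trans (Vec.map-cong ℚ.*-zeroˡ u) (Vec.map-const u 0ℚ)

  ⊛-distribʳ-+ : ∀ {n} c d (u : Vect n) → (c + d) ⊛ u ≡ (c ⊛ u) ⊕ (d ⊛ u)
  ⊛-distribʳ-+ c d []      = refl
  ⊛-distribʳ-+ c d (x ∷ u) = cong₂ _∷_ (ℚ.*-distribʳ-+ x c d) (⊛-distribʳ-+ c d u)

  ℕtoℚ-suc-⊛ : ∀ {n} m (u : Vect n) → ℕtoℚ (suc m) ⊛ u ≡ u ⊕ (ℕtoℚ m ⊛ u)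
  ℕtoℚ-suc-⊛ m u = begin
    ℕtoℚ (suc m) ⊛ u            ≡⟨ cong (_⊛ u) (ℕtoℚ-suc m) ⟩
    (1ℚ + ℕtoℚ m) ⊛ u           ≡⟨ ⊛-distribʳ-+ 1ℚ (ℕtoℚ m) u ⟩
    (1ℚ ⊛ u) ⊕ (ℕtoℚ m ⊛ u)     ≡⟨ cong (_⊕ (ℕtoℚ m ⊛ u)) (⊛-identityˡ u) ⟩
    u ⊕ (ℕtoℚ m ⊛ u)            ∎
    where open ≡-Reasoning

  ⊛-cancelˡ-pos : ∀ {n} {c} (u v : Vect n) → 0ℚ < c → c ⊛ u ≡ c ⊛ v → u ≡ v
  ⊛-cancelˡ-pos []      []      _   _  = refl
  ⊛-cancelˡ-pos {c = c} (x ∷ u) (y ∷ v) 0<c eq =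
    cong₂ _∷_ x≡y (⊛-cancelˡ-pos u v 0<c (cong Vec.tail eq))
    where
    instance _ = positive 0<c
    cx≡cy : c * x ≡ c * y
    cx≡cy = cong Vec.head eq
    x≡y : x ≡ y
    x≡y = ℚ.≤-antisym (ℚ.*-cancelˡ-≤-pos c (ℚ.≤-reflexive cx≡cy))
                      (ℚ.*-cancelˡ-≤-pos c (ℚ.≤-reflexive (sym cx≡cy)))

  a⊛v⊖-a⊛u≡a⊛[v⊕u] : ∀ {n} a (v u : Vect n) → (a ⊛ v) ⊖ ((- a) ⊛ u) ≡ a ⊛ (v ⊕ u)
  a⊛v⊖-a⊛u≡a⊛[v⊕u] a []      []      = refl
  a⊛v⊖-a⊛u≡a⊛[v⊕u] a (y ∷ v) (x ∷ u) =
    cong₂ _∷_ (solve 3 (λ a y x → a :* y :- (:- a) :* x := a :* (y :+ x)) refl a y x)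
              (a⊛v⊖-a⊛u≡a⊛[v⊕u] a v u)

  ⟨⟩-comm : ∀ {n} (u v : Vect n) → ⟨ u , v ⟩ ≡ ⟨ v , u ⟩
  ⟨⟩-comm u v = cong (Vec.foldr _ _+_ 0ℚ) (Vec.zipWith-comm ℚ.*-comm u v)

  ⟨⟩-zeroʳ : ∀ {n} (u : Vect n) → ⟨ u , zeroV ⟩ ≡ 0ℚ
  ⟨⟩-zeroʳ []      = refl
  ⟨⟩-zeroʳ (x ∷ u) = trans (cong₂ _+_ (ℚ.*-zeroʳ x) (⟨⟩-zeroʳ u)) (ℚ.+-identityˡ 0ℚ)

  ⟨⟩-distribˡ-⊕ : ∀ {n} (u v w : Vect n) → ⟨ u , v ⊕ w ⟩ ≡ ⟨ u , v ⟩ + ⟨ u , w ⟩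
  ⟨⟩-distribˡ-⊕ []      []      []      = sym (ℚ.+-identityˡ 0ℚ)
  ⟨⟩-distribˡ-⊕ (x ∷ u) (y ∷ v) (z ∷ w) =
    trans (cong (x * (y + z) +_) (⟨⟩-distribˡ-⊕ u v w))
          (solve 5 (λ x y z p q → x :* (y :+ z) :+ (p :+ q) := (x :* y :+ p) :+ (x :* z :+ q))
                 refl x y z ⟨ u , v ⟩ ⟨ u , w ⟩)

  ⟨⟩-distribʳ-⊕ : ∀ {n} (u v w : Vect n) → ⟨ v ⊕ w , u ⟩ ≡ ⟨ v , u ⟩ + ⟨ w , u ⟩
  ⟨⟩-distribʳ-⊕ u v w = begin
    ⟨ v ⊕ w , u ⟩          ≡⟨ ⟨⟩-comm (v ⊕ w) u ⟩
    ⟨ u , v ⊕ w ⟩          ≡⟨ ⟨⟩-distribˡ-⊕ u v w ⟩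
    ⟨ u , v ⟩ + ⟨ u , w ⟩  ≡⟨ cong₂ _+_ (⟨⟩-comm u v) (⟨⟩-comm u w) ⟩
    ⟨ v , u ⟩ + ⟨ w , u ⟩  ∎
    where open ≡-Reasoning

  ⟨u,u⟩≥0 : ∀ {n} (u : Vect n) → 0ℚ ≤ ⟨ u , u ⟩
  ⟨u,u⟩≥0 []      = ℚ.≤-refl
  ⟨u,u⟩≥0 (x ∷ u) = ℚ.+-mono-≤ (0≤x*x x) (⟨u,u⟩≥0 u)

  ⟨u,u⟩≤0⇒u≡0 : ∀ {n} (u : Vect n) → ⟨ u , u ⟩ ≤ 0ℚ → u ≡ zeroV
  ⟨u,u⟩≤0⇒u≡0 []      _ = refl
  ⟨u,u⟩≤0⇒u≡0 (x ∷ u) ≤0 = cong₂ _∷_ x≡0 (⟨u,u⟩≤0⇒u≡0 u rest≤0)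
    where
    rest≤0 : ⟨ u , u ⟩ ≤ 0ℚ
    rest≤0 = x+y≤0⇒x≤0 (0≤x*x x) (ℚ.≤-trans (ℚ.≤-reflexive (ℚ.+-comm ⟨ u , u ⟩ (x * x))) ≤0)
    x≡0 : x ≡ 0ℚ
    x≡0 with x ℚ.≟ 0ℚ
    ... | yes x≡0 = x≡0
    ... | no x≢0  = contradiction (x≢0⇒0<x*x x≢0) (≤⇒≯ (x+y≤0⇒x≤0 (⟨u,u⟩≥0 u) ≤0))

  u≢0⇒⟨u,u⟩>0 : ∀ {n} {u : Vect n} → u ≢ zeroV → 0ℚ < ⟨ u , u ⟩
  u≢0⇒⟨u,u⟩>0 {u = u} u≢0 = ℚ.≰⇒> (u≢0 ∘ ⟨u,u⟩≤0⇒u≡0 u)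

  ⟨u⊕v,u⊕v⟩-expand : ∀ {n} (u v : Vect n) →
                     ⟨ u ⊕ v , u ⊕ v ⟩ ≡ (⟨ u , u ⟩ + ⟨ u , v ⟩) + (⟨ v , v ⟩ + ⟨ u , v ⟩)
  ⟨u⊕v,u⊕v⟩-expand u v = begin
    ⟨ u ⊕ v , u ⊕ v ⟩
      ≡⟨ ⟨⟩-distribˡ-⊕ (u ⊕ v) u v ⟩
    ⟨ u ⊕ v , u ⟩ + ⟨ u ⊕ v , v ⟩
      ≡⟨ cong₂ _+_ (⟨⟩-distribʳ-⊕ u u v) (⟨⟩-distribʳ-⊕ v u v) ⟩
    (⟨ u , u ⟩ + ⟨ v , u ⟩) + (⟨ u , v ⟩ + ⟨ v , v ⟩)
      ≡⟨ cong₂ _+_ (cong (⟨ u , u ⟩ +_) (⟨⟩-comm v u)) (ℚ.+-comm ⟨ u , v ⟩ ⟨ v , v ⟩) ⟩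
    (⟨ u , u ⟩ + ⟨ u , v ⟩) + (⟨ v , v ⟩ + ⟨ u , v ⟩)
      ∎
    where open ≡-Reasoning

module _ where
  open import Data.Fin.Subset using (Subset; _∈_; _∉_; _⊆_; _⊂_; _∩_; _-_; ∣_∣; inside; outside)
  open import Data.Fin.Subset.Properties
  open import Data.Vec using (here; there)
  import Data.Fin.Properties as Fin
  open import Relation.Nullary.Decidable using (_→-dec_)
  open import Function using (const)

  x∉p-x : ∀ {m} (p : Subset m) x → x ∉ p - x
  x∉p-x (_ ∷ p) Fin.zero    ()
  x∉p-x (_ ∷ p) (Fin.suc x) (there x∈p-x) = x∉p-x p x x∈p-x

  x∈p-y⇒x≢y : ∀ {m} {p : Subset m} {x y} → x ∈ p - y → x ≢ y
  x∈p-y⇒x≢y {p = p} x∈p-y refl = x∉p-x p _ x∈p-y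

  x∈p∧x∉p-y⇒x≡y : ∀ {m} {p : Subset m} {x y} → x ∈ p → x ∉ p - y → x ≡ y
  x∈p∧x∉p-y⇒x≡y {x = x} {y} x∈p x∉p-y with x Fin.≟ y
  ... | yes x≡y = x≡y
  ... | no x≢y  = contradiction (x∈p∧x≢y⇒x∈p-y x∈p x≢y) x∉p-y

  ∣p∣≡1+∣p-x∣ : ∀ {m} {p : Subset m} {x} → x ∈ p → ∣ p ∣ ≡ suc ∣ p - x ∣
  ∣p∣≡1+∣p-x∣ {p = inside ∷ p}  here = cong (suc ∘ ∣_∣) (sym (p─⊥≡p p))
  ∣p∣≡1+∣p-x∣ {p = inside ∷ p}  (there x∈p) = cong suc (∣p∣≡1+∣p-x∣ x∈p)
  ∣p∣≡1+∣p-x∣ {p = outside ∷ p} (there x∈p) = ∣p∣≡1+∣p-x∣ x∈p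

  x∉q⇒p∩q⊆p-x : ∀ {m} {p q : Subset m} {x} → x ∉ q → p ∩ q ⊆ p - x
  x∉q⇒p∩q⊆p-x {p = p} {q} x∉q y∈p∩q with y∈p , y∈q ← x∈p∩q⁻ p q y∈p∩q =
    x∈p∧x≢y⇒x∈p-y y∈p λ { refl → x∉q y∈q }

  x∉p⇒p∩q⊆q-x : ∀ {m} {p q : Subset m} {x} → x ∉ p → p ∩ q ⊆ q - x
  x∉p⇒p∩q⊆q-x {p = p} {q} x∉p y∈p∩q with y∈p , y∈q ← x∈p∩q⁻ p q y∈p∩q =
    x∈p∧x≢y⇒x∈p-y y∈q λ { refl → x∉p y∈p }

  p-x∩q≡[p∩q]-x : ∀ {m} (p q : Subset m) x → (p - x) ∩ q ≡ (p ∩ q) - x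
  p-x∩q≡[p∩q]-x p q x = ⊆-antisym lhs⊆rhs rhs⊆lhs
    where
    lhs⊆rhs : (p - x) ∩ q ⊆ (p ∩ q) - x
    lhs⊆rhs y∈ with y∈p-x , y∈q ← x∈p∩q⁻ (p - x) q y∈ =
      x∈p∧x≢y⇒x∈p-y (x∈p∩q⁺ (p─q⊆p p _ y∈p-x , y∈q)) (x∈p-y⇒x≢y y∈p-x)
    rhs⊆lhs : (p ∩ q) - x ⊆ (p - x) ∩ q
    rhs⊆lhs y∈ with y∈p , y∈q ← x∈p∩q⁻ p q (p─q⊆p (p ∩ q) _ y∈) =
      x∈p∩q⁺ (x∈p∧x≢y⇒x∈p-y y∈p (x∈p-y⇒x≢y y∈) , y∈q)

  x∉q⇒p-x∩q≡p∩q : ∀ {m} (p q : Subset m) {x} → x ∉ q → (p - x) ∩ q ≡ p ∩ q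
  x∉q⇒p-x∩q≡p∩q p q {x} x∉q = ⊆-antisym lhs⊆rhs rhs⊆lhs
    where
    lhs⊆rhs : (p - x) ∩ q ⊆ p ∩ q
    lhs⊆rhs y∈ with y∈p-x , y∈q ← x∈p∩q⁻ (p - x) q y∈ = x∈p∩q⁺ (p─q⊆p p _ y∈p-x , y∈q)
    rhs⊆lhs : p ∩ q ⊆ (p - x) ∩ q
    rhs⊆lhs y∈ with y∈p , y∈q ← x∈p∩q⁻ p q y∈ =
      x∈p∩q⁺ (x∉q⇒p∩q⊆p-x x∉q y∈ , y∈q)

  p-x⊆q⊆p⇒q≡p⊎q≡p-x : ∀ {m} {p q : Subset m} {x} → p - x ⊆ q → q ⊆ p → q ≡ p ⊎ q ≡ p - x
  p-x⊆q⊆p⇒q≡p⊎q≡p-x {p = p} {q} {x} p-x⊆q q⊆p with x ∈? q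
  ... | yes x∈q = inj₁ (⊆-antisym q⊆p p⊆q)
    where
    p⊆q : p ⊆ q
    p⊆q {y} y∈p with y Fin.≟ x
    ... | yes refl = x∈q
    ... | no y≢x   = p-x⊆q (x∈p∧x≢y⇒x∈p-y y∈p y≢x)
  ... | no x∉q  = inj₂ (⊆-antisym (λ y∈q → x∈p∧x≢y⇒x∈p-y (q⊆p y∈q) λ { refl → x∉q y∈q }) p-x⊆q)

  p⊆q∧p≢q⇒p⊂q : ∀ {m} {p q : Subset m} → p ⊆ q → p ≢ q → p ⊂ q
  p⊆q∧p≢q⇒p⊂q {m} {p} {q} p⊆q p≢q
    with x , x∈q↛x∈p ← Fin.¬∀⟶∃¬ m (λ x → x ∈ q → x ∈ p) (λ x → x ∈? q →-dec x ∈? p)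
                               (λ q⊆p → p≢q (⊆-antisym p⊆q (q⊆p _))) =
    p⊆q , x , decidable-stable (x ∈? q) (λ x∉q → x∈q↛x∈p (λ x∈q → contradiction x∈q x∉q)) , x∈q↛x∈p ∘ const

  ∈-tabulate⁻ : ∀ {m} {P : Fin m → Set} (P? : ∀ i → Dec (P i)) {i} →
                i ∈ Vec.tabulate (λ j → does (P? j)) → P i
  ∈-tabulate⁻ P? {i} i∈
    with P? i | trans (sym (Vec.lookup∘tabulate (λ j → does (P? j)) i)) (Vec.[]=⇒lookup i∈)
  ... | yes Pi | _ = Pi

  ∈-tabulate⁺ : ∀ {m} {P : Fin m → Set} (P? : ∀ i → Dec (P i)) {i} →
                P i → i ∈ Vec.tabulate (λ j → does (P? j))
  ∈-tabulate⁺ P? {i} Pi =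
    Vec.lookup⇒[]= i _ (trans (Vec.lookup∘tabulate (λ j → does (P? j)) i) (dec-true (P? i) Pi))

module _ where
  open import Data.Integer using (+_; _+_; _-_)
  open import Data.Integer.Solver using (module +-*-Solver)
  open +-*-Solver

  m-n≡m-[1+n]+1 : ∀ m n → + m - + n ≡ (+ m - + suc n) + + 1
  m-n≡m-[1+n]+1 m n = solve 2 (λ m n → m :- n := (m :- (con (+ 1) :+ n)) :+ con (+ 1)) refl (+ m) (+ n)

  [1+m]-n≡m-n+1 : ∀ m n → + suc m - + n ≡ (+ m - + n) + + 1
  [1+m]-n≡m-n+1 m n = solve 2 (λ m n → (con (+ 1) :+ m) :- n := (m :- n) :+ con (+ 1)) refl (+ m) (+ n)

module _ {n k : ℕ} (Φ : RootSystem n k) where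
  open RootSystem Φ
  open import Data.Rational using (ℚ; 0ℚ; 1ℚ; _+_; _*_; -_; _≤_; _<_)
  import Data.Rational.Properties as ℚ
  open import Data.Rational.Solver using (module +-*-Solver)
  open +-*-Solver
  import Data.Integer as ℤ
  import Data.Nat.Properties as ℕ
  import Data.Nat.Induction as ℕ
  open import Data.Fin.Subset using (Subset; _∈_; _∉_; _⊆_; _∩_; _∪_; _-_; ∣_∣)
  open import Data.Fin.Subset.Properties
  private module V = AbelianGroup (⊕-abelianGroup n)
  open V using () renaming (assoc to ⊕-assoc; comm to ⊕-comm; identityʳ to ⊕-identityʳ)
  open import Algebra.Properties.AbelianGroup (⊕-abelianGroup n) using (identityʳ-unique; inverseʳ-unique)
  open import Algebra.Properties.CommutativeSemigroup V.commutativeSemigroup using (x∙yz≈y∙xz; xy∙z≈x∙zy)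

  -- Obtuse pairs of roots

  0<⟨α,α⟩ : ∀ i → 0ℚ < ⟨ root i , root i ⟩
  0<⟨α,α⟩ i = u≢0⇒⟨u,u⟩>0 (nonzero i)

  reflection-sum : ∀ i j → two * ⟨ root i , root j ⟩ ≡ - ⟨ root i , root i ⟩ →
                   ∃[ l ] root l ≡ root j ⊕ root i
  reflection-sum i j cartan≡-1 with l , reflected ← reflect i j =
    l , ⊛-cancelˡ-pos (root l) (root j ⊕ root i) (0<⟨α,α⟩ i) (begin
      a ⊛ root l                                            ≡⟨ reflected ⟩
      (a ⊛ root j) ⊖ ((two * ⟨ root i , root j ⟩) ⊛ root i)
        ≡⟨ cong (λ c → (a ⊛ root j) ⊖ (c ⊛ root i)) cartan≡-1 ⟩
      (a ⊛ root j) ⊖ ((- a) ⊛ root i)                       ≡⟨ a⊛v⊖-a⊛u≡a⊛[v⊕u] a (root j) (root i) ⟩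
      a ⊛ (root j ⊕ root i)                                 ∎)
    where
    a : ℚ
    a = ⟨ root i , root i ⟩
    open ≡-Reasoning

  -- the negative integer ⟨α^∨,β⟩ is either -1 or at most -2
  obtuse-cartan : Crystallographic → ∀ i j → ⟨ root i , root j ⟩ < 0ℚ →
                  two * ⟨ root i , root j ⟩ ≡ - ⟨ root i , root i ⟩
                  ⊎ ⟨ root i , root i ⟩ + ⟨ root i , root j ⟩ ≤ 0ℚ
  obtuse-cartan cryst i j x<0 with cryst i j
  ... | ℤ.+ m , 2x≡ma =
    contradiction (ℚ.*-monoʳ-<-pos two x<0)
                  (≤⇒≯ (subst (0ℚ ≤_) (sym 2x≡ma) (0≤p*q (0≤ℕtoℚ m) (ℚ.<⇒≤ (0<⟨α,α⟩ i)))))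
  ... | ℤ.-[1+ zero ] , 2x≡-a =
    inj₁ (trans 2x≡-a (solve 1 (λ a → (:- con 1ℚ) :* a := :- a) refl ⟨ root i , root i ⟩))
  ... | ℤ.-[1+ suc m ] , 2x≡-[2+m]a = inj₂ (ℚ.*-cancelˡ-≤-pos two (begin
      two * (a + x)                        ≡⟨ ℚ.*-distribˡ-+ two a x ⟩
      two * a + two * x                    ≡⟨ cong (two * a +_) 2x≡-[2+m]a ⟩
      two * a + - ℕtoℚ (suc (suc m)) * a   ≡⟨ cong (λ c → two * a + - c * a) 2+m≡1+[1+q] ⟩
      two * a + - (1ℚ + (1ℚ + q)) * a
        ≡⟨ solve 2 (λ a q → (con 1ℚ :+ con 1ℚ) :* a :+ (:- (con 1ℚ :+ (con 1ℚ :+ q))) :* a := :- (q :* a))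
                   refl a q ⟩
      - (q * a)                            ≤⟨ ℚ.neg-antimono-≤ (0≤p*q (0≤ℕtoℚ m) (ℚ.<⇒≤ (0<⟨α,α⟩ i))) ⟩
      0ℚ                                   ∎))
    where
    a x q : ℚ
    a = ⟨ root i , root i ⟩
    x = ⟨ root i , root j ⟩
    q = ℕtoℚ m
    2+m≡1+[1+q] : ℕtoℚ (suc (suc m)) ≡ 1ℚ + (1ℚ + q)
    2+m≡1+[1+q] = trans (ℕtoℚ-suc (suc m)) (cong (1ℚ +_) (ℕtoℚ-suc m))
    open ℚ.≤-Reasoning

  obtuse⇒sum-root : Crystallographic → ∀ i j → ⟨ root i , root j ⟩ < 0ℚ →
                    root j ≢ (- 1ℚ) ⊛ root i → ∃[ l ] root l ≡ root i ⊕ root j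
  obtuse⇒sum-root cryst i j x<0 j≢-i
    with obtuse-cartan cryst i j x<0 | obtuse-cartan cryst j i (subst (_< 0ℚ) (⟨⟩-comm (root i) (root j)) x<0)
  ... | inj₁ cartan≡-1 | _ =
    let l , l≡j+i = reflection-sum i j cartan≡-1 in l , trans l≡j+i (⊕-comm (root j) (root i))
  ... | inj₂ _ | inj₁ cartan≡-1 = reflection-sum j i cartan≡-1
  ... | inj₂ i-short | inj₂ j-short = contradiction j≡-i j≢-i
    where
    ‖i+j‖²≤0 : ⟨ root i ⊕ root j , root i ⊕ root j ⟩ ≤ 0ℚ
    ‖i+j‖²≤0 = begin
      ⟨ root i ⊕ root j , root i ⊕ root j ⟩      ≡⟨ ⟨u⊕v,u⊕v⟩-expand (root i) (root j) ⟩
      (a + x) + (b + x)                          ≡⟨ cong (λ y → (a + x) + (b + y)) (⟨⟩-comm (root i) (root j)) ⟩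
      (a + x) + (b + ⟨ root j , root i ⟩)        ≤⟨ ℚ.+-mono-≤ i-short j-short ⟩
      0ℚ                                         ∎
      where
      a b x : ℚ
      a = ⟨ root i , root i ⟩
      b = ⟨ root j , root j ⟩
      x = ⟨ root i , root j ⟩
      open ℚ.≤-Reasoning
    j≡-i : root j ≡ (- 1ℚ) ⊛ root i
    j≡-i = trans (inverseʳ-unique (root i) (root j) (⟨u,u⟩≤0⇒u≡0 _ ‖i+j‖²≤0)) (sym (-1⊛u≡negV (root i)))

  -- Φ-posets are pointed

  sumRoots : List (Fin k) → Vect n
  sumRoots []       = zeroV
  sumRoots (i ∷ is) = root i ⊕ sumRoots is

  sumRoots-++ : ∀ is js → sumRoots (is ++ js) ≡ sumRoots is ⊕ sumRoots js
  sumRoots-++ []       js = sym (V.identityˡ (sumRoots js))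
  sumRoots-++ (i ∷ is) js = trans (cong (root i ⊕_) (sumRoots-++ is js)) (sym (⊕-assoc (root i) _ _))

  sumRoots-replicate : ∀ c i → sumRoots (replicate c i) ≡ ℕtoℚ c ⊛ root i
  sumRoots-replicate zero    i = sym (⊛-zeroˡ (root i))
  sumRoots-replicate (suc c) i =
    trans (cong (root i ⊕_) (sumRoots-replicate c i)) (sym (ℕtoℚ-suc-⊛ c (root i)))

  sumRoots-extract : ∀ {P Q : Fin k → Set} {M} → Any P M → All Q M →
                     ∃₂ λ β M′ → P β × All Q (β ∷ M′) × sumRoots M ≡ root β ⊕ sumRoots M′ × length M′ ℕ.< length M
  sumRoots-extract (here Pβ) (Qβ ∷ QM) = _ , _ , Pβ , Qβ ∷ QM , refl , ℕ.≤-refl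
  sumRoots-extract {M = i ∷ M} (there P∈M) (Qi ∷ QM)
    with β , M′ , Pβ , Qβ ∷ QM′ , ΣM≡β+ΣM′ , shorter ← sumRoots-extract P∈M QM =
    β , i ∷ M′ , Pβ , Qβ ∷ Qi ∷ QM′ ,
    trans (cong (root i ⊕_) ΣM≡β+ΣM′) (x∙yz≈y∙xz (root i) (root β) (sumRoots M′)) , ℕ.s≤s shorter

  0≤⟨α,ΣM⟩ : ∀ {α} M → All (λ β → 0ℚ ≤ ⟨ root α , root β ⟩) M → 0ℚ ≤ ⟨ root α , sumRoots M ⟩
  0≤⟨α,ΣM⟩ {α} []      []           = ℚ.≤-reflexive (sym (⟨⟩-zeroʳ (root α)))
  0≤⟨α,ΣM⟩ {α} (β ∷ M) (0≤αβ ∷ 0≤αM) = begin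
    0ℚ                                              ≤⟨ ℚ.+-mono-≤ 0≤αβ (0≤⟨α,ΣM⟩ M 0≤αM) ⟩
    ⟨ root α , root β ⟩ + ⟨ root α , sumRoots M ⟩   ≡⟨ ⟨⟩-distribˡ-⊕ (root α) (root β) (sumRoots M) ⟨
    ⟨ root α , sumRoots (β ∷ M) ⟩                   ∎
    where open ℚ.≤-Reasoning

  _≺[_]_ : Fin k → Subset k → Fin k → Set
  β ≺[ R ] α = ∃₂ λ γ M → All (_∈ R) (γ ∷ M) × root α ≡ root β ⊕ sumRoots (γ ∷ M)

  ≺-trans : ∀ {R} → Transitive (_≺[ R ]_)
  ≺-trans {R} {δ} {β} {α} (γ , M , R∋ , β≡δ+Σ) (γ′ , M′ , R∋′ , α≡β+Σ′) =
    γ , M ++ γ′ ∷ M′ , All.++⁺ R∋ R∋′ , (begin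
      root α                                             ≡⟨ α≡β+Σ′ ⟩
      root β ⊕ sumRoots (γ′ ∷ M′)                        ≡⟨ cong (_⊕ sumRoots (γ′ ∷ M′)) β≡δ+Σ ⟩
      (root δ ⊕ sumRoots (γ ∷ M)) ⊕ sumRoots (γ′ ∷ M′)   ≡⟨ ⊕-assoc (root δ) _ _ ⟩
      root δ ⊕ (sumRoots (γ ∷ M) ⊕ sumRoots (γ′ ∷ M′))   ≡⟨ cong (root δ ⊕_) (sumRoots-++ (γ ∷ M) (γ′ ∷ M′)) ⟨
      root δ ⊕ sumRoots (γ ∷ M ++ γ′ ∷ M′)               ∎)
    where open ≡-Reasoning

  ℕ-multiple-of-root : ∀ {α β} c → root α ≡ ℕtoℚ c ⊛ root β → α ≡ β
  ℕ-multiple-of-root {α} {β} c α≡cβ with reduced β α (ℕtoℚ c) α≡cβ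
  ... | inj₁ c≡1  = injective (trans α≡cβ (trans (cong (_⊛ root β) c≡1) (⊛-identityˡ (root β))))
  ... | inj₂ c≡-1 = contradiction c≡-1 (ℕtoℚ≢-1 c)

  combination⇒≺ : ∀ {R α β γ} a b → β ≢ α → γ ≢ α → β ∈ R → γ ∈ R →
                  root α ≡ (ℕtoℚ a ⊛ root β) ⊕ (ℕtoℚ b ⊛ root γ) → β ≺[ R ] α
  combination⇒≺ {β = β} {γ} zero b _ γ≢α _ _ α≡ =
    contradiction (ℕ-multiple-of-root b (trans α≡ 0β+bγ≡bγ)) (γ≢α ∘ sym)
    where
    0β+bγ≡bγ : (0ℚ ⊛ root β) ⊕ (ℕtoℚ b ⊛ root γ) ≡ ℕtoℚ b ⊛ root γ
    0β+bγ≡bγ = trans (cong (_⊕ (ℕtoℚ b ⊛ root γ)) (⊛-zeroˡ (root β))) (V.identityˡ _)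
  combination⇒≺ {β = β} {γ} (suc a) zero β≢α _ _ _ α≡ =
    contradiction (ℕ-multiple-of-root (suc a) (trans α≡ aβ+0γ≡aβ)) (β≢α ∘ sym)
    where
    aβ+0γ≡aβ : (ℕtoℚ (suc a) ⊛ root β) ⊕ (0ℚ ⊛ root γ) ≡ ℕtoℚ (suc a) ⊛ root β
    aβ+0γ≡aβ = trans (cong ((ℕtoℚ (suc a) ⊛ root β) ⊕_) (⊛-zeroˡ (root γ))) (⊕-identityʳ _)
  combination⇒≺ {α = α} {β} {γ} (suc a) (suc b) _ _ β∈R γ∈R α≡ =
    γ , replicate b γ ++ replicate a β , All.++⁺ (All.replicate⁺ (suc b) γ∈R) (All.replicate⁺ a β∈R) , (begin
      root α                                                 ≡⟨ α≡ ⟩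
      (ℕtoℚ (suc a) ⊛ root β) ⊕ B                            ≡⟨ cong (_⊕ B) (ℕtoℚ-suc-⊛ a (root β)) ⟩
      (root β ⊕ A) ⊕ B                                       ≡⟨ xy∙z≈x∙zy (root β) A B ⟩
      root β ⊕ (B ⊕ A)                                       ≡⟨ cong (root β ⊕_) Σ≡B+A ⟨
      root β ⊕ sumRoots (replicate (suc b) γ ++ replicate a β) ∎)
    where
    A B : Vect n
    A = ℕtoℚ a ⊛ root β
    B = ℕtoℚ (suc b) ⊛ root γ
    Σ≡B+A : sumRoots (replicate (suc b) γ ++ replicate a β) ≡ B ⊕ A
    Σ≡B+A = trans (sumRoots-++ (replicate (suc b) γ) (replicate a β))
                  (cong₂ _⊕_ (sumRoots-replicate (suc b) γ) (sumRoots-replicate a β))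
    open ≡-Reasoning

  0<⟨α,α+ΣM⟩ : ∀ {α} M → All (λ β → 0ℚ ≤ ⟨ root α , root β ⟩) M → 0ℚ < ⟨ root α , sumRoots (α ∷ M) ⟩
  0<⟨α,α+ΣM⟩ {α} M nonobtuse = begin-strict
    0ℚ                                              <⟨ 0<⟨α,α⟩ α ⟩
    ⟨ root α , root α ⟩                             ≡⟨ ℚ.+-identityʳ ⟨ root α , root α ⟩ ⟨
    ⟨ root α , root α ⟩ + 0ℚ                        ≤⟨ ℚ.+-monoʳ-≤ ⟨ root α , root α ⟩ (0≤⟨α,ΣM⟩ M nonobtuse) ⟩
    ⟨ root α , root α ⟩ + ⟨ root α , sumRoots M ⟩   ≡⟨ ⟨⟩-distribˡ-⊕ (root α) (root α) (sumRoots M) ⟨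
    ⟨ root α , sumRoots (α ∷ M) ⟩                   ∎
    where open ℚ.≤-Reasoning

  nonobtuse? : ∀ α β → Dec (0ℚ ≤ ⟨ root α , root β ⟩)
  nonobtuse? α β = 0ℚ ℚ.≤? ⟨ root α , root β ⟩

  module _ (cryst : Crystallographic) {R : Subset k} (antiR : Antisymmetric R) (closedR : Closed R) where

    -- an obtuse pair γ, β of the sum merges into the root γ + β of R; without one, ⟨γ , Σ⟩ > 0
    shorter-zero-sum : ∀ {γ M} → All (_∈ R) (γ ∷ M) → sumRoots (γ ∷ M) ≡ zeroV →
                       ∃₂ λ γ′ M′ → All (_∈ R) (γ′ ∷ M′) × sumRoots (γ′ ∷ M′) ≡ zeroV × length M′ ℕ.< length M
    shorter-zero-sum {γ} {M} (γ∈R ∷ M⊆R) Σ≡0 with all? (nonobtuse? γ) M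
    ... | yes all-nonobtuse =
      ⊥-elim (ℚ.<-irrefl (sym ⟨γ,Σ⟩≡0) (0<⟨α,α+ΣM⟩ M all-nonobtuse))
      where
      ⟨γ,Σ⟩≡0 : ⟨ root γ , sumRoots (γ ∷ M) ⟩ ≡ 0ℚ
      ⟨γ,Σ⟩≡0 = trans (cong (λ v → ⟨ root γ , v ⟩) Σ≡0) (⟨⟩-zeroʳ (root γ))
    ... | no ¬all-nonobtuse
      with β , M′ , β-obtuse , β∈R ∷ M′⊆R , ΣM≡β+ΣM′ , shorter
             ← sumRoots-extract (¬All⇒Any¬ (nonobtuse? γ) M ¬all-nonobtuse) M⊆R
      with l , l≡γ+β ← obtuse⇒sum-root cryst γ β (ℚ.≰⇒> β-obtuse) (antiR γ β γ∈R β∈R) =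
      l , M′ , l∈R ∷ M′⊆R , Σ′≡0 , shorter
      where
      l∈R : l ∈ R
      l∈R = closedR γ β 1 1 l γ∈R β∈R
                    (trans l≡γ+β (sym (cong₂ _⊕_ (⊛-identityˡ (root γ)) (⊛-identityˡ (root β)))))
      Σ′≡0 : root l ⊕ sumRoots M′ ≡ zeroV
      Σ′≡0 = begin
        root l ⊕ sumRoots M′                ≡⟨ cong (_⊕ sumRoots M′) l≡γ+β ⟩
        (root γ ⊕ root β) ⊕ sumRoots M′     ≡⟨ ⊕-assoc (root γ) (root β) (sumRoots M′) ⟩
        root γ ⊕ (root β ⊕ sumRoots M′)     ≡⟨ cong (root γ ⊕_) ΣM≡β+ΣM′ ⟨
        root γ ⊕ sumRoots M                 ≡⟨ Σ≡0 ⟩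
        zeroV                               ∎
        where open ≡-Reasoning

    sumRoots≢0 : ∀ {γ M} → All (_∈ R) (γ ∷ M) → sumRoots (γ ∷ M) ≢ zeroV
    sumRoots≢0 {M = M} = descend (ℕ.<-wellFounded (length M))
      where
      descend : ∀ {γ M} → Acc ℕ._<_ (length M) → All (_∈ R) (γ ∷ M) → sumRoots (γ ∷ M) ≢ zeroV
      descend (acc smaller) R∋ Σ≡0 with _ , _ , R∋′ , Σ′≡0 , shorter ← shorter-zero-sum R∋ Σ≡0 =
        descend (smaller shorter) R∋′ Σ′≡0

    ≺-irrefl : Irreflexive _≡_ (_≺[ R ]_)
    ≺-irrefl refl (_ , _ , R∋ , α≡α+Σ) = sumRoots≢0 R∋ (identityʳ-unique _ _ (sym α≡α+Σ))

    ≺-isStrictPartialOrder : IsStrictPartialOrder _≡_ (_≺[ R ]_)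
    ≺-isStrictPartialOrder = record
      { isEquivalence = isEquivalence
      ; irrefl        = ≺-irrefl
      ; trans         = ≺-trans
      ; <-resp-≈      = resp₂ (_≺[ R ]_)
      }

    ≺-wellFounded : WellFounded (_≺[ R ]_)
    ≺-wellFounded = spo-wellFounded ≺-isStrictPartialOrder

  -- Removing a root from a Φ-poset

  antisymmetric-⊆ : ∀ {R S} → S ⊆ R → Antisymmetric R → Antisymmetric S
  antisymmetric-⊆ S⊆R antiR i j i∈S j∈S = antiR i j (S⊆R i∈S) (S⊆R j∈S)

  ΦPoset-∩ : ∀ {R S} → IsΦPoset R → IsΦPoset S → IsΦPoset (R ∩ S)
  ΦPoset-∩ {R} {S} (antiR , closedR) (_ , closedS) = antisymmetric-⊆ (p∩q⊆p R S) antiR , closed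
    where
    closed : Closed (R ∩ S)
    closed i j a b l i∈ j∈ l≡
      with i∈R , i∈S ← x∈p∩q⁻ R S i∈
      with j∈R , j∈S ← x∈p∩q⁻ R S j∈ =
      x∈p∩q⁺ (closedR i j a b l i∈R j∈R l≡ , closedS i j a b l i∈S j∈S l≡)

  module _ (cryst : Crystallographic) {P Q : Subset k} (closedP : Closed P)
           (antiQ : Antisymmetric Q) (closedQ : Closed Q) where

    lower-root : ∀ {α i j} a b → α ∉ P → i ∈ Q → j ∈ Q → i ≢ α → j ≢ α →
                 root α ≡ (ℕtoℚ a ⊛ root i) ⊕ (ℕtoℚ b ⊛ root j) → ∃ λ β → β ∈ Q × β ∉ P × β ≺[ Q ] α
    lower-root {α} {i} {j} a b α∉P i∈Q j∈Q i≢α j≢α α≡ with i ∈? P | j ∈? P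
    ... | no i∉P  | _       = i , i∈Q , i∉P , combination⇒≺ a b i≢α j≢α i∈Q j∈Q α≡
    ... | yes _   | no j∉P  = j , j∈Q , j∉P , combination⇒≺ b a j≢α i≢α j∈Q i∈Q (trans α≡ (⊕-comm _ _))
    ... | yes i∈P | yes j∈P = contradiction (closedP i j a b α i∈P j∈P α≡) α∉P

    -- a ≺[ Q ]-minimal element of Q ∖ P is removable; as closedness quantifies over all of ℕ
    -- it is undecidable, so the conclusion holds only up to double negation
    removable : ∀ {α₀} → α₀ ∈ Q → α₀ ∉ P → ¬ ¬ (∃ λ α → α ∈ Q × α ∉ P × IsΦPoset (Q - α))
    removable α₀∈Q α₀∉P none = go (≺-wellFounded cryst antiQ closedQ _) α₀∈Q α₀∉P
      where
      go : ∀ {α} → Acc (_≺[ Q ]_) α → α ∈ Q → α ∉ P → ⊥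
      go {α} (acc below) α∈Q α∉P = none (α , α∈Q , α∉P , antisymmetric-⊆ (p─q⊆p Q _) antiQ , Q-α-closed)
        where
        Q-α-closed : Closed (Q - α)
        Q-α-closed i j a b l i∈ j∈ l≡ with l ∈? Q - α
        ... | yes l∈ = l∈
        ... | no l∉
          with refl ← x∈p∧x∉p-y⇒x≡y (closedQ i j a b l (p─q⊆p Q _ i∈) (p─q⊆p Q _ j∈) l≡) l∉
          with β , β∈Q , β∉P , β≺α ← lower-root a b α∉P (p─q⊆p Q _ i∈) (p─q⊆p Q _ j∈)
                                                 (x∈p-y⇒x≢y i∈) (x∈p-y⇒x≢y j∈) l≡ =
          ⊥-elim (go (below β≺α) β∈Q β∉P)

  -- The weak order

  module _ (f : Vect n) where

    ∈Φ⁺⇒0<f : ∀ {i} → i ∈ Φ⁺ f → 0ℚ < ⟨ f , root i ⟩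
    ∈Φ⁺⇒0<f = ∈-tabulate⁻ (λ i → 0ℚ ℚ.<? ⟨ f , root i ⟩)

    ∈Φ⁻⇒f<0 : ∀ {i} → i ∈ Φ⁻ f → ⟨ f , root i ⟩ < 0ℚ
    ∈Φ⁻⇒f<0 = ∈-tabulate⁻ (λ i → ⟨ f , root i ⟩ ℚ.<? 0ℚ)

    ∈Φ⁺⇒∉Φ⁻ : ∀ {i} → i ∈ Φ⁺ f → i ∉ Φ⁻ f
    ∈Φ⁺⇒∉Φ⁻ i∈Φ⁺ i∈Φ⁻ = ℚ.<-asym (∈Φ⁺⇒0<f i∈Φ⁺) (∈Φ⁻⇒f<0 i∈Φ⁻)

    generic⇒∈Φ⁺⊎∈Φ⁻ : Generic f → ∀ i → i ∈ Φ⁺ f ⊎ i ∈ Φ⁻ f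
    generic⇒∈Φ⁺⊎∈Φ⁻ gen i with ℚ.<-cmp ⟨ f , root i ⟩ 0ℚ
    ... | tri< f<0 _ _ = inj₂ (∈-tabulate⁺ (λ i → ⟨ f , root i ⟩ ℚ.<? 0ℚ) f<0)
    ... | tri≈ _ f≡0 _ = contradiction f≡0 (gen i)
    ... | tri> _ _ 0<f = inj₁ (∈-tabulate⁺ (λ i → 0ℚ ℚ.<? ⟨ f , root i ⟩) 0<f)

    WeakLE⁺ : ∀ {R S i} → WeakLE f R S → i ∈ S → i ∈ Φ⁺ f → i ∈ R
    WeakLE⁺ {R} (S⁺⊆R⁺ , _) i∈S i∈Φ⁺ = proj₁ (x∈p∩q⁻ R _ (S⁺⊆R⁺ (x∈p∩q⁺ (i∈S , i∈Φ⁺))))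

    WeakLE⁻ : ∀ {R S i} → WeakLE f R S → i ∈ R → i ∈ Φ⁻ f → i ∈ S
    WeakLE⁻ {S = S} (_ , R⁻⊆S⁻) i∈R i∈Φ⁻ = proj₁ (x∈p∩q⁻ S _ (R⁻⊆S⁻ (x∈p∩q⁺ (i∈R , i∈Φ⁻))))

    mkWeakLE : ∀ {R S} → (∀ {i} → i ∈ S → i ∈ Φ⁺ f → i ∈ R) → (∀ {i} → i ∈ R → i ∈ Φ⁻ f → i ∈ S) → WeakLE f R S
    mkWeakLE {R} {S} S⁺⊆R R⁻⊆S =
      (λ {i} i∈ → let i∈S , i∈Φ⁺ = x∈p∩q⁻ S _ i∈ in x∈p∩q⁺ (S⁺⊆R i∈S i∈Φ⁺ , i∈Φ⁺)) ,
      (λ {i} i∈ → let i∈R , i∈Φ⁻ = x∈p∩q⁻ R _ i∈ in x∈p∩q⁺ (R⁻⊆S i∈R i∈Φ⁻ , i∈Φ⁻))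

    between⇒weakLE : ∀ {R S T} → WeakLE f R S → R ∩ S ⊆ T → T ⊆ R ∪ S → WeakLE f R T × WeakLE f T S
    between⇒weakLE {R} {S} R≤S R∩S⊆T T⊆R∪S =
      mkWeakLE (λ i∈T i∈Φ⁺ → [ id , (λ i∈S → WeakLE⁺ R≤S i∈S i∈Φ⁺) ]′ (x∈p∪q⁻ R S (T⊆R∪S i∈T)))
               (λ i∈R i∈Φ⁻ → R∩S⊆T (x∈p∩q⁺ (i∈R , WeakLE⁻ R≤S i∈R i∈Φ⁻))) ,
      mkWeakLE (λ i∈S i∈Φ⁺ → R∩S⊆T (x∈p∩q⁺ (WeakLE⁺ R≤S i∈S i∈Φ⁺ , i∈S)))
               (λ i∈T i∈Φ⁻ → [ (λ i∈R → WeakLE⁻ R≤S i∈R i∈Φ⁻) , id ]′ (x∈p∪q⁻ R S (T⊆R∪S i∈T)))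

    weakLE⇒between : Generic f → ∀ {R S T} → WeakLE f R T → WeakLE f T S → R ∩ S ⊆ T × T ⊆ R ∪ S
    weakLE⇒between gen {R} {S} {T} R≤T T≤S = R∩S⊆T , T⊆R∪S
      where
      R∩S⊆T : R ∩ S ⊆ T
      R∩S⊆T {i} i∈R∩S with i∈R , i∈S ← x∈p∩q⁻ R S i∈R∩S with generic⇒∈Φ⁺⊎∈Φ⁻ gen i
      ... | inj₁ i∈Φ⁺ = WeakLE⁺ T≤S i∈S i∈Φ⁺
      ... | inj₂ i∈Φ⁻ = WeakLE⁻ R≤T i∈R i∈Φ⁻
      T⊆R∪S : T ⊆ R ∪ S
      T⊆R∪S {i} i∈T with generic⇒∈Φ⁺⊎∈Φ⁻ gen i
      ... | inj₁ i∈Φ⁺ = x∈p∪q⁺ (inj₁ (WeakLE⁺ R≤T i∈T i∈Φ⁺))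
      ... | inj₂ i∈Φ⁻ = x∈p∪q⁺ (inj₂ (WeakLE⁻ T≤S i∈T i∈Φ⁻))

    cover-endpoint : ∀ {P R S T} → CoverIn P f R S → P T → WeakLE f R T × WeakLE f T S → T ≡ R ⊎ T ≡ S
    cover-endpoint {R = R} {S} {T} (_ , _ , _ , nothing-between) P-T (R≤T , T≤S)
      with Vec.≡-dec Bool._≟_ T R | Vec.≡-dec Bool._≟_ T S
    ... | yes T≡R | _       = inj₁ T≡R
    ... | no _    | yes T≡S = inj₂ T≡S
    ... | no T≢R  | no T≢S  = ⊥-elim (nothing-between T P-T (R≤T , T≢R ∘ sym) (T≤S , T≢S))

    data WeakCover : Subset k → Subset k → Set where
      remove⁺ : ∀ {R α} → α ∈ R → α ∈ Φ⁺ f → WeakCover R (R - α)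
      insert⁻ : ∀ {S β} → β ∈ S → β ∈ Φ⁻ f → WeakCover (S - β) S

    WeakCover⇒nothing-between : Generic f → ∀ {R S} → WeakCover R S →
                                ∀ T → WeakLT f R T → WeakLT f T S → ⊥
    WeakCover⇒nothing-between gen (remove⁺ {R} {α} _ _) T (R≤T , R≢T) (T≤S , T≢S)
      with R∩S⊆T , T⊆R∪S ← weakLE⇒between gen R≤T T≤S
      with p-x⊆q⊆p⇒q≡p⊎q≡p-x (λ i∈ → R∩S⊆T (x∈p∩q⁺ (p─q⊆p R _ i∈ , i∈)))
                             (λ i∈T → [ id , p─q⊆p R _ ]′ (x∈p∪q⁻ R (R - α) (T⊆R∪S i∈T)))
    ... | inj₁ T≡R   = R≢T (sym T≡R)
    ... | inj₂ T≡R-α = T≢S T≡R-α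
    WeakCover⇒nothing-between gen (insert⁻ {S} {β} _ _) T (R≤T , R≢T) (T≤S , T≢S)
      with R∩S⊆T , T⊆R∪S ← weakLE⇒between gen R≤T T≤S
      with p-x⊆q⊆p⇒q≡p⊎q≡p-x (λ i∈ → R∩S⊆T (x∈p∩q⁺ (i∈ , p─q⊆p S _ i∈)))
                             (λ i∈T → [ p─q⊆p S _ , id ]′ (x∈p∪q⁻ (S - β) S (T⊆R∪S i∈T)))
    ... | inj₁ T≡S   = T≢S T≡S
    ... | inj₂ T≡S-β = R≢T (sym T≡S-β)

    WeakCover⇒rank : ∀ {R S} → WeakCover R S → rank f S ≡ rank f R ℤ.+ ℤ.+ 1
    WeakCover⇒rank (remove⁺ {R} {α} α∈R α∈Φ⁺)
      rewrite x∉q⇒p-x∩q≡p∩q R (Φ⁻ f) (∈Φ⁺⇒∉Φ⁻ α∈Φ⁺)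
            | p-x∩q≡[p∩q]-x R (Φ⁺ f) α
            | ∣p∣≡1+∣p-x∣ (x∈p∩q⁺ (α∈R , α∈Φ⁺))
            = m-n≡m-[1+n]+1 ∣ R ∩ Φ⁻ f ∣ ∣ (R ∩ Φ⁺ f) - α ∣
    WeakCover⇒rank (insert⁻ {S} {β} β∈S β∈Φ⁻)
      rewrite x∉q⇒p-x∩q≡p∩q S (Φ⁺ f) (λ β∈Φ⁺ → ∈Φ⁺⇒∉Φ⁻ β∈Φ⁺ β∈Φ⁻)
            | p-x∩q≡[p∩q]-x S (Φ⁻ f) β
            | ∣p∣≡1+∣p-x∣ (x∈p∩q⁺ (β∈S , β∈Φ⁻))
            = [1+m]-n≡m-n+1 ∣ (S ∩ Φ⁻ f) - β ∣ ∣ S ∩ Φ⁺ f ∣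

    ∈R∖S⇒∈Φ⁺ : Generic f → ∀ {R S α} → WeakLE f R S → α ∈ R → α ∉ S → α ∈ Φ⁺ f
    ∈R∖S⇒∈Φ⁺ gen {α = α} R≤S α∈R α∉S with generic⇒∈Φ⁺⊎∈Φ⁻ gen α
    ... | inj₁ α∈Φ⁺ = α∈Φ⁺
    ... | inj₂ α∈Φ⁻ = contradiction (WeakLE⁻ R≤S α∈R α∈Φ⁻) α∉S

    ∈S∖R⇒∈Φ⁻ : Generic f → ∀ {R S α} → WeakLE f R S → α ∉ R → α ∈ S → α ∈ Φ⁻ f
    ∈S∖R⇒∈Φ⁻ gen {α = α} R≤S α∉R α∈S with generic⇒∈Φ⁺⊎∈Φ⁻ gen α
    ... | inj₁ α∈Φ⁺ = contradiction (WeakLE⁺ R≤S α∈S α∈Φ⁺) α∉R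
    ... | inj₂ α∈Φ⁻ = α∈Φ⁻

    module _ (cryst : Crystallographic) (gen : Generic f) where

      shrink-cover : ∀ {R S} → CoverIn IsΦPoset f R S → S ⊆ R → ¬ ¬ WeakCover R S
      shrink-cover {R} {S} cover@((antiR , closedR) , (_ , closedS) , (R≤S , R≢S) , _) S⊆R
        with α₀ , α₀∈R , α₀∉S ← proj₂ (p⊆q∧p≢q⇒p⊂q S⊆R (R≢S ∘ sym)) =
        ¬¬-map remove (removable cryst closedS antiR closedR α₀∈R α₀∉S)
        where
        remove : (∃ λ α → α ∈ R × α ∉ S × IsΦPoset (R - α)) → WeakCover R S
        remove (α , α∈R , α∉S , R-α-poset)
          with cover-endpoint cover R-α-poset
                 (between⇒weakLE R≤S (x∉q⇒p∩q⊆p-x α∉S) (⊆-trans (p─q⊆p R _) (p⊆p∪q S)))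
        ... | inj₁ R-α≡R = contradiction (subst (α ∈_) (sym R-α≡R) α∈R) (x∉p-x R α)
        ... | inj₂ R-α≡S = subst (WeakCover R) R-α≡S (remove⁺ α∈R (∈R∖S⇒∈Φ⁺ gen R≤S α∈R α∉S))

      grow-cover : ∀ {R S} → CoverIn IsΦPoset f R S → R ⊆ S → ¬ ¬ WeakCover R S
      grow-cover {R} {S} cover@((_ , closedR) , (antiS , closedS) , (R≤S , R≢S) , _) R⊆S
        with α₀ , α₀∈S , α₀∉R ← proj₂ (p⊆q∧p≢q⇒p⊂q R⊆S R≢S) =
        ¬¬-map insert (removable cryst closedR antiS closedS α₀∈S α₀∉R)
        where
        insert : (∃ λ α → α ∈ S × α ∉ R × IsΦPoset (S - α)) → WeakCover R S
        insert (α , α∈S , α∉R , S-α-poset)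
          with cover-endpoint cover S-α-poset
                 (between⇒weakLE R≤S (x∉p⇒p∩q⊆q-x α∉R) (⊆-trans (p─q⊆p S _) (q⊆p∪q R S)))
        ... | inj₁ S-α≡R = subst (λ X → WeakCover X S) S-α≡R (insert⁻ α∈S (∈S∖R⇒∈Φ⁻ gen R≤S α∉R α∈S))
        ... | inj₂ S-α≡S = contradiction (subst (α ∈_) (sym S-α≡S) α∈S) (x∉p-x S α)

      ΦPoset-cover⇒WeakCover : ∀ {R S} → CoverIn IsΦPoset f R S → ¬ ¬ WeakCover R S
      ΦPoset-cover⇒WeakCover {R} {S} cover@(R-poset , S-poset , (R≤S , _) , _)
        with cover-endpoint cover (ΦPoset-∩ R-poset S-poset)
               (between⇒weakLE R≤S id (⊆-trans (p∩q⊆p R S) (p⊆p∪q S)))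
      ... | inj₁ R∩S≡R = grow-cover cover (p∩q⊆q R S ∘ subst (_ ∈_) (sym R∩S≡R))
      ... | inj₂ R∩S≡S = shrink-cover cover (p∩q⊆p R S ∘ subst (_ ∈_) (sym R∩S≡S))

-- opened only here: ℤ's _+_ would clash with ℚ's in the sections above
open import Data.Integer using (_+_; +_)
import Data.Integer as ℤ

proposition3p20 : ∀ {n k : ℕ} (Φ : RootSystem n k) → RootSystem.Crystallographic Φ
    → (f : Vect n) → RootSystem.Generic Φ f
    → (R S : Subset k)
    → RootSystem.CoverIn Φ (RootSystem.IsΦPoset Φ) f R S
    → RootSystem.CoverIn Φ (RootSystem.AllSubsets Φ) f R S
      × (RootSystem.rank Φ f S ≡ RootSystem.rank Φ f R + + 1)
proposition3p20 Φ cryst f gen R S cover@(_ , _ , R<S , _) =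
  (tt , tt , R<S , λ T _ R<T T<S → weak-cover (λ c → WeakCover⇒nothing-between Φ f gen c T R<T T<S)) ,
  decidable-stable (RootSystem.rank Φ f S ℤ.≟ RootSystem.rank Φ f R + + 1)
                   (¬¬-map (WeakCover⇒rank Φ f) weak-cover)
  where
  weak-cover : ¬ ¬ WeakCover Φ f R S
  weak-cover = ΦPoset-cover⇒WeakCover Φ f cryst gen cover
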